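{- Let $L$ be a field of characteristic $p$, let $d\ge 2$ be an integer, let $\alpha_1,\alpha_2,\beta\in L$, and for $\lambda\in\overline{L}$ let $f_\lambda(z)=z^d+\lambda$. Let $C(\alpha_1,\alpha_2;\beta)$ be the set of all $\lambda\in\overline{L}$ for which there exist $m,n\in\mathbb{N}$ with $f_\lambda^m(\alpha_1)=f_\lambda^n(\alpha_2)=\beta$. If $C(\alpha_1,\alpha_2;\beta)$ is nonempty, then $\alpha_1\in\overline{\mathbb{F}_p(\alpha_2,\beta)}$ and $\alpha_2\in\overline{\mathbb{F}_p(\alpha_1,\beta)}$.
   Context: $\mathbb{N}$ denotes the set of positive integers; $\overline{L}$ is an algebraic closure of $L$; for a subfield $K\subseteq \overline{L}$, $\overline{K}$ denotes its algebraic closure inside $\overline{L}$; $f_\lambda^n$ is the $n$-th compositional iterate of $f_\lambda$. -}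

module Defs where

open import Level using (Level; _⊔_; suc)
open import Algebra.Bundles using (CommutativeRing)
open import Data.Nat as ℕ using (ℕ; zero) renaming (suc to 1+)
open import Data.Nat.Primality using (Prime)
open import Data.List using (List; []; _∷_; _++_; [_]; length)
open import Data.List.Relation.Unary.Any using (Any)
open import Data.Product using (Σ; ∃; _×_; _,_)
open import Relation.Nullary using (¬_)
import Data.List.Relation.Unary.All

record Field (c ℓ : Level) : Set (suc (c ⊔ ℓ)) where
  field
    commRing : CommutativeRing c ℓ
  open CommutativeRing commRing public
  field
    1≉0  : ¬ (1# ≈ 0#)
    inv  : ∀ x → ¬ (x ≈ 0#) → ∃ λ y → (x * y) ≈ 1#

module FieldTheory {c ℓ : Level} (F : Field c ℓ) where
  open Field F

  ι : ℕ → Carrier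
  ι zero   = 0#
  ι (1+ n) = 1# + ι n

  HasChar : ℕ → Set ℓ
  HasChar p = ι p ≈ 0#

  -- Polynomials in one variable as coefficient lists, lowest degree first.
  Poly : Set c
  Poly = List Carrier

  eval : Poly → Carrier → Carrier
  eval []       x = 0#
  eval (a ∷ as) x = a + x * eval as x

  -- F is algebraically closed: every monic polynomial of degree ≥ 1 has a root.
  AlgClosed : Set (c ⊔ ℓ)
  AlgClosed = ∀ (a : Carrier) (as : List Carrier) →
              ∃ λ x → eval ((a ∷ as) ++ [ 1# ]) x ≈ 0#

  Pred : Set (suc (c ⊔ ℓ))
  Pred = Carrier → Set (c ⊔ ℓ)

  record IsSubfield (K : Pred) : Set (c ⊔ ℓ) where
    field
      resp : ∀ {x y} → x ≈ y → K x → K y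
      has0 : K 0#
      has1 : K 1#
      +-cl : ∀ {x y} → K x → K y → K (x + y)
      neg  : ∀ {x} → K x → K (- x)
      *-cl : ∀ {x y} → K x → K y → K (x * y)
      inv-cl : ∀ {x y} → K x → (x * y) ≈ 1# → K y

  -- The subfield of F generated by the elements of the list S
  -- (i.e. the prime field with the elements of S adjoined).
  data Gen (S : List Carrier) : Pred where
    gen  : ∀ {x} → Any (λ s → s ≈ x) S → Gen S x
    zer  : Gen S 0#
    one  : Gen S 1#
    plus : ∀ {x y} → Gen S x → Gen S y → Gen S (x + y)
    neg  : ∀ {x} → Gen S x → Gen S (- x)
    mul  : ∀ {x y} → Gen S x → Gen S y → Gen S (x * y)
    inverse : ∀ {x y} → Gen S x → (x * y) ≈ 1# → Gen S y
    resp : ∀ {x y} → x ≈ y → Gen S x → Gen S y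

  Algebraic : Pred → Carrier → Set (c ⊔ ℓ)
  Algebraic K x = Σ Poly λ P →
    Data.List.Relation.Unary.All.All K P × Any (λ a → ¬ (a ≈ 0#)) P × eval P x ≈ 0#

  IsAlgClosureOf : Pred → Set (c ⊔ ℓ)
  IsAlgClosureOf K = IsSubfield K × AlgClosed × (∀ x → Algebraic K x)

  pow : Carrier → ℕ → Carrier
  pow z zero   = 1#
  pow z (1+ n) = z * pow z n

  f : ℕ → Carrier → Carrier → Carrier
  f d λ' z = pow z d + λ'

  iter : ℕ → Carrier → ℕ → Carrier → Carrier
  iter d λ' zero   z = z
  iter d λ' (1+ n) z = f d λ' (iter d λ' n z)

  -- λ ∈ C(α₁, α₂; β): there exist m, n ∈ ℕ = {1,2,...} with
  -- f_λ^m(α₁) = f_λ^n(α₂) = β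
  InC : ℕ → Carrier → Carrier → Carrier → Carrier → Set ℓ
  InC d α₁ α₂ β λ' = Σ ℕ λ m → Σ ℕ λ n →
    (1 ℕ.≤ m) × (1 ℕ.≤ n) × (iter d λ' m α₁ ≈ β) × (iter d λ' n α₂ ≈ β)

{-# OPTIONS --safe #-}
module Submission where

-- Let K be the subring generated by α₂ and β, and write f_λ(z) = z^d + λ.
-- Since n ≥ 1, f_λ^n(α₂) − β is a monic polynomial in λ over K of degree d^(n−1),
-- so λ is integral over K. Integral elements are closed under subtraction (the
-- determinant trick, made constructive by fraction-free elimination), and z is
-- integral as soon as z^d = f_λ(z) − λ is. Walking back along
-- f_λ^m(α₁) = β therefore carries integrality from β to α₁, and an integral
-- element is algebraic. The second claim is symmetric. Neither L nor the
-- characteristic plays any role: the argument works in any field.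

open import Defs
open Field using (Carrier)
open FieldTheory
open import Level using (Level)
open import Data.Nat using (ℕ; _≤_)
open import Data.Nat.Primality using (Prime)
open import Data.List using (_∷_; [])
open import Data.Product using (Σ; _×_)

open import Level using (_⊔_)
open import Algebra.Bundles using (Monoid; CommutativeRing)
open import Data.Nat as ℕ using (zero; suc; z≤n; s≤s)
import Data.Nat.Properties as ℕ
open import Data.Fin as Fin using (Fin; toℕ; combine; remQuot; inject₁; fromℕ; _↑ˡ_; _↑ʳ_)
import Data.Fin.Properties as Fin
open import Data.Vec.Functional as Vector using (Vector; head; init; last)
open import Data.Product using (∃; ∃₂; _,_; proj₁; proj₂; -,_)
open import Data.Sum using (inj₁; inj₂)
open import Data.List.Relation.Unary.All as All using (All)
open import Data.List.Relation.Unary.Any using (Any; here; there)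
open import Relation.Binary.PropositionalEquality as ≡ using (_≡_)
open import Relation.Nullary using (¬_)

module _ {a ℓ} (M : Monoid a ℓ) where
  open Monoid M renaming (Carrier to A)
  open import Algebra.Properties.Monoid.Sum M using (sum; sum-syntax)

  sum-↑ : ∀ m {n} (f : Vector A (m ℕ.+ n)) →
          sum f ≈ sum (λ i → f (i ↑ˡ n)) ∙ sum (λ j → f (m ↑ʳ j))
  sum-↑ zero    f = sym (identityˡ _)
  sum-↑ (suc m) f = trans (∙-congˡ (sum-↑ m (λ k → f (Fin.suc k)))) (sym (assoc _ _ _))

  sum-combine : ∀ m {n} (f : Vector A (m ℕ.* n)) →
                sum f ≈ ∑[ i < m ] ∑[ j < n ] f (combine i j)
  sum-combine zero        f = refl
  sum-combine (suc m) {n} f = trans (sum-↑ n f) (∙-congˡ (sum-combine m (λ k → f (n ↑ʳ k))))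

record IsSubring {r ℓ k} (R : CommutativeRing r ℓ)
                 (K : CommutativeRing.Carrier R → Set k) : Set (r ⊔ k) where
  open CommutativeRing R
  field
    0∈       : K 0#
    1∈       : K 1#
    +-closed : ∀ {x y} → K x → K y → K (x + y)
    -‿closed : ∀ {x} → K x → K (- x)
    *-closed : ∀ {x y} → K x → K y → K (x * y)

module Integrality {r ℓ k} (R : CommutativeRing r ℓ)
                   {K : CommutativeRing.Carrier R → Set k} (K-subring : IsSubring R K) where
  open CommutativeRing R renaming (Carrier to A) hiding (zero)
  open IsSubring K-subring
  open import Algebra.Properties.Semiring.Exp semiring using (_^_; ^-congˡ; ^-assocʳ; ^-homo-*)
  open import Algebra.Properties.Semiring.Sum semiring
    using (sum; sum-syntax; sum-cong-≋; ∑-distrib-+; *-distribˡ-sum; *-distribʳ-sum; sum-init-last)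
  open import Algebra.Properties.Ring ring using (-1*x≈-x; -‿distribʳ-*; -‿distribˡ-*; [y-z]x≈yx-zx)
  open import Algebra.Properties.AbelianGroup +-abelianGroup using (⁻¹-∙-comm)
  open import Algebra.Properties.Group +-group using (inverseʳ-unique; ε⁻¹≈ε; //-rightDividesʳ)
  open import Algebra.Solver.Ring.NaturalCoefficients.Default commutativeSemiring
    using (solve; _:=_; _:+_; _:*_)
  open import Relation.Binary.Reasoning.Setoid setoid

  ^-closed : ∀ {a} n → K a → K (a ^ n)
  ^-closed zero    a∈K = 1∈
  ^-closed (suc n) a∈K = *-closed a∈K (^-closed n a∈K)

  infix 4 _∈K[_]<_

  -- Horner form: v ≈ a₀ + x (a₁ + x (⋯ + x aₙ₋₁)) with every aᵢ ∈ K, i.e. v is the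
  -- value at x of a polynomial over K of degree < n.
  data _∈K[_]<_ : A → A → ℕ → Set (r ⊔ ℓ ⊔ k) where
    nil    : ∀ {v x} → v ≈ 0# → v ∈K[ x ]< 0
    horner : ∀ {v x n a b} → K a → b ∈K[ x ]< n → v ≈ a + x * b → v ∈K[ x ]< suc n

  poly-resp : ∀ {u v x n} → u ≈ v → u ∈K[ x ]< n → v ∈K[ x ]< n
  poly-resp u≈v (nil u≈0)         = nil (trans (sym u≈v) u≈0)
  poly-resp u≈v (horner a∈K p u≈) = horner a∈K p (trans (sym u≈v) u≈)

  poly-resp-var : ∀ {v x y n} → x ≈ y → v ∈K[ x ]< n → v ∈K[ y ]< n
  poly-resp-var x≈y (nil v≈0)         = nil v≈0
  poly-resp-var x≈y (horner a∈K p v≈) =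
    horner a∈K (poly-resp-var x≈y p) (trans v≈ (+-congˡ (*-congʳ x≈y)))

  poly-0 : ∀ {x} n → 0# ∈K[ x ]< n
  poly-0     zero    = nil refl
  poly-0 {x} (suc n) = horner 0∈ (poly-0 n) (sym (trans (+-identityˡ _) (zeroʳ x)))

  poly-const : ∀ {a x n} → K a → a ∈K[ x ]< suc n
  poly-const {a} {x} {n} a∈K = horner a∈K (poly-0 n) (sym (trans (+-congˡ (zeroʳ x)) (+-identityʳ a)))

  poly-+ : ∀ {u v x n} → u ∈K[ x ]< n → v ∈K[ x ]< n → u + v ∈K[ x ]< n
  poly-+ (nil u≈0) (nil v≈0) = nil (trans (+-cong u≈0 v≈0) (+-identityʳ 0#))
  poly-+ {x = x} (horner {a = a} {b} a∈K p u≈) (horner {a = a′} {b′} a′∈K q v≈) =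
    horner (+-closed a∈K a′∈K) (poly-+ p q) (trans (+-cong u≈ v≈)
      (solve 5 (λ a b a′ b′ x → (a :+ x :* b) :+ (a′ :+ x :* b′) := (a :+ a′) :+ x :* (b :+ b′))
             refl a b a′ b′ x))

  poly-neg : ∀ {v x n} → v ∈K[ x ]< n → - v ∈K[ x ]< n
  poly-neg (nil v≈0) = nil (trans (-‿cong v≈0) ε⁻¹≈ε)
  poly-neg {v} {x} (horner {a = a} {b} a∈K p v≈) = horner (-‿closed a∈K) (poly-neg p) (begin
    - v              ≈⟨ -‿cong v≈ ⟩
    - (a + x * b)    ≈⟨ ⁻¹-∙-comm a (x * b) ⟨
    - a + - (x * b)  ≈⟨ +-congˡ (-‿distribʳ-* x b) ⟩
    - a + x * - b    ∎)

  poly-scale : ∀ {s v x n} → K s → v ∈K[ x ]< n → s * v ∈K[ x ]< n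
  poly-scale {s} s∈K (nil v≈0) = nil (trans (*-congˡ v≈0) (zeroʳ s))
  poly-scale {s} {x = x} s∈K (horner {a = a} {b} a∈K p v≈) =
    horner (*-closed s∈K a∈K) (poly-scale s∈K p) (trans (*-congˡ v≈)
      (solve 4 (λ s a b x → s :* (a :+ x :* b) := s :* a :+ x :* (s :* b)) refl s a b x))

  poly-weaken : ∀ {v x m n} → m ≤ n → v ∈K[ x ]< m → v ∈K[ x ]< n
  poly-weaken {n = n} z≤n     (nil v≈0)         = poly-resp (sym v≈0) (poly-0 n)
  poly-weaken         (s≤s m≤n) (horner a∈K p v≈) = horner a∈K (poly-weaken m≤n p) v≈

  poly-x* : ∀ {v x n} → v ∈K[ x ]< n → x * v ∈K[ x ]< suc n
  poly-x* p = horner 0∈ p (sym (+-identityˡ _))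

  poly-x^* : ∀ {v x n} t → v ∈K[ x ]< n → x ^ t * v ∈K[ x ]< t ℕ.+ n
  poly-x^* zero    p = poly-resp (sym (*-identityˡ _)) p
  poly-x^* (suc t) p = poly-resp (sym (*-assoc _ _ _)) (poly-x* (poly-x^* t p))

  poly-* : ∀ {u v x m n} → u ∈K[ x ]< m → v ∈K[ x ]< n → u * v ∈K[ x ]< m ℕ.+ n
  poly-* {v = v} {n = n} (nil u≈0) q = poly-resp (sym (trans (*-congʳ u≈0) (zeroˡ v))) (poly-0 n)
  poly-* {v = v} {x} {suc m} {n} (horner {a = a} {b} a∈K p u≈) q =
    poly-resp (sym (trans (*-congʳ u≈)
                 (solve 4 (λ a b x v → (a :+ x :* b) :* v := a :* v :+ x :* (b :* v)) refl a b x v)))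
      (poly-+ (poly-weaken (ℕ.m≤n⇒m≤1+n (ℕ.m≤n+m n m)) (poly-scale a∈K q)) (poly-x* (poly-* p q)))

  poly-^ : ∀ {x} t → x ^ t ∈K[ x ]< suc t
  poly-^ zero    = poly-const 1∈
  poly-^ (suc t) = poly-x* (poly-^ t)

  poly-^-reduce : ∀ {x n t} → x ^ n ∈K[ x ]< n → t ≤ n → x ^ t ∈K[ x ]< n
  poly-^-reduce {t = t} x^n<n t≤n with ℕ.m≤n⇒m<n∨m≡n t≤n
  ... | inj₁ t<n    = poly-weaken t<n (poly-^ t)
  ... | inj₂ ≡.refl = x^n<n

  poly-∘^ : ∀ {v x e} d → v ∈K[ x ^ suc d ]< e → v ∈K[ x ]< e ℕ.* suc d
  poly-∘^ d (nil v≈0)         = nil v≈0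
  poly-∘^ d (horner a∈K p v≈) =
    poly-resp (sym v≈) (poly-+ (poly-const a∈K) (poly-x^* (suc d) (poly-∘^ d p)))

  Monic : A → ℕ → A → Set (r ⊔ ℓ ⊔ k)
  Monic x n v = ∃ λ p → p ∈K[ x ]< n × v ≈ x ^ n + p

  monic-resp : ∀ {u v x n} → u ≈ v → Monic x n u → Monic x n v
  monic-resp u≈v (p , p<n , u≈) = p , p<n , trans (sym u≈v) u≈

  monic-x : ∀ {x} → Monic x 1 x
  monic-x {x} = 0# , poly-0 1 , sym (trans (+-identityʳ _) (*-identityʳ x))

  monic-+ : ∀ {u v x n} → Monic x n u → v ∈K[ x ]< n → Monic x n (u + v)
  monic-+ (p , p<n , u≈) q = _ , poly-+ p<n q , trans (+-congʳ u≈) (+-assoc _ _ _)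

  monic-*-poly : ∀ {u v x m n} → Monic x m u → v ∈K[ x ]< n → u * v ∈K[ x ]< m ℕ.+ n
  monic-*-poly (p , p<m , u≈) q =
    poly-resp (sym (trans (*-congʳ u≈) (distribʳ _ _ _))) (poly-+ (poly-x^* _ q) (poly-* p<m q))

  monic-* : ∀ {u v x m n} → Monic x m u → Monic x n v → Monic x (m ℕ.+ n) (u * v)
  monic-* {u} {v} {x} {m} {n} (p , p<m , u≈) (q , q<n , v≈) = lower , lower<m+n , (begin
    u * v                              ≈⟨ *-cong u≈ v≈ ⟩
    (x ^ m + p) * (x ^ n + q)          ≈⟨ expand (x ^ m) (x ^ n) p q ⟩
    x ^ m * x ^ n + lower              ≈⟨ +-congʳ (^-homo-* x m n) ⟨
    x ^ (m ℕ.+ n) + lower              ∎)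
    where
    lower = x ^ m * q + (x ^ n * p + p * q)
    lower<m+n : lower ∈K[ x ]< m ℕ.+ n
    lower<m+n = poly-+ (poly-x^* m q<n)
      (poly-+ (≡.subst (x ^ n * p ∈K[ x ]<_) (ℕ.+-comm n m) (poly-x^* n p<m)) (poly-* p<m q<n))
    expand : ∀ X Y p q → (X + p) * (Y + q) ≈ X * Y + (X * q + (Y * p + p * q))
    expand = solve 4 (λ X Y p q → (X :+ p) :* (Y :+ q) := X :* Y :+ (X :* q :+ (Y :* p :+ p :* q))) refl

  monic-^ : ∀ {u x n} → Monic x n u → ∀ t → Monic x (t ℕ.* n) (u ^ t)
  monic-^ _ zero    = 0# , nil refl , sym (+-identityʳ 1#)
  monic-^ m (suc t) = monic-* m (monic-^ m t)

  Integral : A → Set (r ⊔ ℓ ⊔ k)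
  Integral x = ∃ λ n → x ^ n ∈K[ x ]< n

  integral-resp : ∀ {x y} → x ≈ y → Integral x → Integral y
  integral-resp x≈y (n , x^n<n) = n , poly-resp (^-congˡ n x≈y) (poly-resp-var x≈y x^n<n)

  ∈K⇒integral : ∀ {a} → K a → Integral a
  ∈K⇒integral {a} a∈K = 1 , poly-resp (sym (*-identityʳ a)) (poly-const a∈K)

  monic-zero⇒integral : ∀ {x n} → Monic x n 0# → Integral x
  monic-zero⇒integral {x} {n} (p , p<n , 0≈) =
    n , poly-resp (sym (inverseʳ-unique p (x ^ n) (trans (+-comm _ _) (sym 0≈)))) (poly-neg p<n)

  infix 4 _∈Span_

  _∈Span_ : ∀ {n} → A → Vector A n → Set (r ⊔ ℓ ⊔ k)
  _∈Span_ {n} v w = ∃ λ (c : Vector A n) → (∀ j → K (c j)) × v ≈ sum (λ j → c j * w j)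

  span-resp : ∀ {n u v} {w : Vector A n} → u ≈ v → u ∈Span w → v ∈Span w
  span-resp u≈v (c , c⊆K , u≈) = c , c⊆K , trans (sym u≈v) u≈

  span-+ : ∀ {n u v} {w : Vector A n} → u ∈Span w → v ∈Span w → u + v ∈Span w
  span-+ {u = u} {v} {w} (c , c⊆K , u≈) (d , d⊆K , v≈) =
    (λ j → c j + d j) , (λ j → +-closed (c⊆K j) (d⊆K j)) , (begin
      u + v                                          ≈⟨ +-cong u≈ v≈ ⟩
      sum (λ j → c j * w j) + sum (λ j → d j * w j)  ≈⟨ ∑-distrib-+ (λ j → c j * w j) (λ j → d j * w j) ⟨
      sum (λ j → c j * w j + d j * w j)              ≈⟨ sum-cong-≋ (λ j → distribʳ (w j) (c j) (d j)) ⟨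
      sum (λ j → (c j + d j) * w j)                  ∎)

  span-neg : ∀ {n v} {w : Vector A n} → v ∈Span w → - v ∈Span w
  span-neg {v = v} {w} (c , c⊆K , v≈) =
    (λ j → - c j) , (λ j → -‿closed (c⊆K j)) , (begin
      - v                             ≈⟨ -‿cong v≈ ⟩
      - sum (λ j → c j * w j)         ≈⟨ -1*x≈-x _ ⟨
      - 1# * sum (λ j → c j * w j)    ≈⟨ *-distribˡ-sum (- 1#) (λ j → c j * w j) ⟩
      sum (λ j → - 1# * (c j * w j))  ≈⟨ sum-cong-≋ (λ j → trans (-1*x≈-x _) (-‿distribˡ-* (c j) (w j))) ⟩
      sum (λ j → - c j * w j)         ∎)

  infixl 7 _⊗_

  _⊗_ : ∀ {m n} → Vector A m → Vector A n → Vector A (m ℕ.* n)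
  _⊗_ {m} {n} X Y k = X (proj₁ (remQuot {m} n k)) * Y (proj₂ (remQuot {m} n k))

  ⊗-combine : ∀ {m n} (X : Vector A m) (Y : Vector A n) i j → (X ⊗ Y) (combine i j) ≡ X i * Y j
  ⊗-combine {m} {n} X Y i j =
    ≡.cong (λ (ij : Fin m × Fin n) → X (proj₁ ij) * Y (proj₂ ij)) (Fin.remQuot-combine i j)

  span-⊗ : ∀ {m n u v} {X : Vector A m} {Y : Vector A n} → u ∈Span X → v ∈Span Y → u * v ∈Span X ⊗ Y
  span-⊗ {m} {n} {u} {v} {X} {Y} (c , c⊆K , u≈) (d , d⊆K , v≈) =
    c ⊗ d , (λ k → *-closed (c⊆K _) (d⊆K _)) , (begin
      u * v                                            ≈⟨ *-cong u≈ v≈ ⟩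
      sum (λ i → c i * X i) * sum (λ j → d j * Y j)    ≈⟨ *-distribʳ-sum _ (λ i → c i * X i) ⟩
      ∑[ i < m ] (c i * X i * sum (λ j → d j * Y j))   ≈⟨ sum-cong-≋ (λ i → *-distribˡ-sum (c i * X i) dY) ⟩
      ∑[ i < m ] ∑[ j < n ] (c i * X i * (d j * Y j))  ≈⟨ sum-cong-≋ (λ i → sum-cong-≋ (regroup i)) ⟩
      ∑[ i < m ] ∑[ j < n ] ((c ⊗ d) (combine i j) * (X ⊗ Y) (combine i j))
                                                       ≈⟨ sum-combine +-monoid m (λ k → (c ⊗ d) k * (X ⊗ Y) k) ⟨
      sum (λ k → (c ⊗ d) k * (X ⊗ Y) k)                ∎)
    where
    dY = λ j → d j * Y j
    regroup : ∀ i j → c i * X i * (d j * Y j) ≈ (c ⊗ d) (combine i j) * (X ⊗ Y) (combine i j)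
    regroup i j rewrite ⊗-combine c d i j | ⊗-combine X Y i j =
      solve 4 (λ c x d y → c :* x :* (d :* y) := c :* d :* (x :* y)) refl (c i) (X i) (d j) (Y j)

  powers : ∀ {n} → A → Vector A n
  powers x i = x ^ toℕ i

  poly⇒span : ∀ {v x n} → v ∈K[ x ]< n → v ∈Span powers {n} x
  poly⇒span (nil v≈0) = (λ ()) , (λ ()) , v≈0
  poly⇒span {v} {x} (horner {a = a} {b} a∈K p v≈) with poly⇒span p
  ... | c , c⊆K , b≈ = a Vector.∷ c , (λ { Fin.zero → a∈K ; (Fin.suc j) → c⊆K j }) , (begin
    v                                           ≈⟨ v≈ ⟩
    a + x * b                                   ≈⟨ +-cong (sym (*-identityʳ a)) (*-congˡ b≈) ⟩
    a * 1# + x * sum (λ j → c j * x ^ toℕ j)    ≈⟨ +-congˡ (*-distribˡ-sum x (λ j → c j * x ^ toℕ j)) ⟩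
    a * 1# + sum (λ j → x * (c j * x ^ toℕ j))  ≈⟨ +-congˡ (sum-cong-≋ (λ j → x[cy]≈c[xy] x (c j) _)) ⟩
    a * 1# + sum (λ j → c j * (x * x ^ toℕ j))  ∎)
    where
    x[cy]≈c[xy] : ∀ x c y → x * (c * y) ≈ c * (x * y)
    x[cy]≈c[xy] = solve 3 (λ x c y → x :* (c :* y) := c :* (x :* y)) refl

  pivot-row : ∀ {n} D (N w : Vector A (suc n)) → D * last w ≈ sum (λ j → N j * w j) →
              (D - last N) * last w ≈ sum (λ j → init N j * init w j)
  pivot-row D N w row = begin
    (D - last N) * last w                  ≈⟨ [y-z]x≈yx-zx (last w) D (last N) ⟩
    D * last w - last N * last w           ≈⟨ +-congʳ (trans row (sum-init-last (λ j → N j * w j))) ⟩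
    S + last N * last w - last N * last w  ≈⟨ //-rightDividesʳ (last N * last w) S ⟩
    S                                      ∎
    where S = sum (λ j → init N j * init w j)

  reduced-row : ∀ {n} a Dᵢ wᵢ (Nᵢ w : Vector A (suc n)) (P : Vector A n) →
                Dᵢ * wᵢ ≈ sum (λ j → Nᵢ j * w j) → a * last w ≈ sum (λ j → P j * init w j) →
                a * Dᵢ * wᵢ ≈ sum (λ j → (last Nᵢ * P j + a * init Nᵢ j) * init w j)
  reduced-row a Dᵢ wᵢ Nᵢ w P row pivot = begin
    a * Dᵢ * wᵢ                                      ≈⟨ *-assoc a Dᵢ wᵢ ⟩
    a * (Dᵢ * wᵢ)                                    ≈⟨ *-congˡ (trans row (sum-init-last (λ j → Nᵢ j * w j))) ⟩
    a * (S + last Nᵢ * last w)                       ≈⟨ move-a a S (last Nᵢ) (last w) ⟩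
    a * S + last Nᵢ * (a * last w)                   ≈⟨ +-congˡ (*-congˡ pivot) ⟩
    a * S + last Nᵢ * sum (λ j → P j * init w j)     ≈⟨ +-cong (*-distribˡ-sum a (λ j → init Nᵢ j * init w j))
                                                                (*-distribˡ-sum (last Nᵢ) (λ j → P j * init w j)) ⟩
    sum (λ j → a * (init Nᵢ j * init w j)) + sum (λ j → last Nᵢ * (P j * init w j))
                                                     ≈⟨ ∑-distrib-+ (λ j → a * (init Nᵢ j * init w j)) _ ⟨
    sum (λ j → a * (init Nᵢ j * init w j) + last Nᵢ * (P j * init w j))
                                                     ≈⟨ sum-cong-≋ (λ j → collect a (init Nᵢ j) (init w j) (last Nᵢ) (P j)) ⟩
    sum (λ j → (last Nᵢ * P j + a * init Nᵢ j) * init w j) ∎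
    where
    S = sum (λ j → init Nᵢ j * init w j)
    move-a : ∀ a S N W → a * (S + N * W) ≈ a * S + N * (a * W)
    move-a = solve 4 (λ a S N W → a :* (S :+ N :* W) := a :* S :+ N :* (a :* W)) refl
    collect : ∀ a N W M P → a * (N * W) + M * (P * W) ≈ (M * P + a * N) * W
    collect = solve 5 (λ a N W M P → a :* (N :* W) :+ M :* (P :* W) := (M :* P :+ a :* N) :* W) refl

  -- A constructive substitute for det (z I − M) w = 0: the system D w = N w is solved for
  -- its last unknown and substituted into the other rows, after clearing the pivot
  -- D − N by cross-multiplication. Diagonals stay monic and the N-entries stay of lower
  -- degree in z, until one monic c with c w₀ = 0 is left.
  eliminate : ∀ {z e} n (D : Vector A (suc n)) (N : Vector (Vector A (suc n)) (suc n)) (w : Vector A (suc n)) →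
              (∀ i → Monic z e (D i)) → (∀ i j → N i j ∈K[ z ]< e) →
              (∀ i → D i * w i ≈ sum (λ j → N i j * w j)) →
              ∃₂ λ e′ c → Monic z e′ c × c * head w ≈ 0#
  eliminate zero D N w D-monic N-poly rows =
    -, -, monic-+ (D-monic Fin.zero) (poly-neg (N-poly Fin.zero Fin.zero)) ,
    pivot-row (D Fin.zero) (N Fin.zero) w (rows Fin.zero)
  eliminate {z} {e} (suc n) D N w D-monic N-poly rows = eliminate n D′ N′ (init w) D′-monic N′-poly rows′
    where
    top = fromℕ (suc n)
    a = D top - N top top
    a-monic : Monic z e a
    a-monic = monic-+ (D-monic top) (poly-neg (N-poly top top))
    D′ : Vector A (suc n)
    D′ i = a * D (inject₁ i)
    N′ : Vector (Vector A (suc n)) (suc n)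
    N′ i j = N (inject₁ i) top * N top (inject₁ j) + a * N (inject₁ i) (inject₁ j)
    D′-monic : ∀ i → Monic z (e ℕ.+ e) (D′ i)
    D′-monic i = monic-* a-monic (D-monic (inject₁ i))
    N′-poly : ∀ i j → N′ i j ∈K[ z ]< e ℕ.+ e
    N′-poly i j = poly-+ (poly-* (N-poly (inject₁ i) top) (N-poly top (inject₁ j)))
                         (monic-*-poly a-monic (N-poly (inject₁ i) (inject₁ j)))
    rows′ : ∀ i → D′ i * init w i ≈ sum (λ j → N′ i j * init w j)
    rows′ i = reduced-row a (D (inject₁ i)) (w (inject₁ i)) (N (inject₁ i)) w (init (N top))
                (rows (inject₁ i)) (pivot-row (D top) (N top) w (rows top))

  determinant-trick : ∀ {n z} (w : Vector A (suc n)) → head w ≈ 1# →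
                      (∀ i → z * w i ∈Span w) → Integral z
  determinant-trick {n} {z} w w₀≈1 z*w∈span
    with eliminate n (λ _ → z) (λ i → proj₁ (z*w∈span i)) w (λ _ → monic-x)
           (λ i j → poly-const (proj₁ (proj₂ (z*w∈span i)) j))
           (λ i → proj₂ (proj₂ (z*w∈span i)))
  ... | _ , c , c-monic , c*w₀≈0 =
    monic-zero⇒integral (monic-resp (trans (sym (trans (*-congˡ w₀≈1) (*-identityʳ c))) c*w₀≈0) c-monic)

  [x-y][uv]≈[xu]v-u[yv] : ∀ x y u v → (x - y) * (u * v) ≈ x * u * v - u * (y * v)
  [x-y][uv]≈[xu]v-u[yv] x y u v = begin
    (x - y) * (u * v)          ≈⟨ [y-z]x≈yx-zx (u * v) x y ⟩
    x * (u * v) - y * (u * v)  ≈⟨ +-cong (sym (*-assoc x u v)) (-‿cong (y[uv]≈u[yv] y u v)) ⟩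
    x * u * v - u * (y * v)    ∎
    where
    y[uv]≈u[yv] : ∀ y u v → y * (u * v) ≈ u * (y * v)
    y[uv]≈u[yv] = solve 3 (λ y u v → y :* (u :* v) := u :* (y :* v)) refl

  integral-sub : ∀ {x y} → Integral x → Integral y → Integral (x - y)
  integral-sub (zero , nil 1≈0) _                = 0 , nil 1≈0
  integral-sub _                (zero , nil 1≈0) = 0 , nil 1≈0
  integral-sub {x} {y} (suc m , x^m<m) (suc n , y^n<n) = determinant-trick W (*-identityˡ 1#) shift
    where
    W : Vector A (suc m ℕ.* suc n)
    W = powers {suc m} x ⊗ powers {suc n} y
    x^-span : ∀ {t} → t ≤ suc m → x ^ t ∈Span powers {suc m} x
    x^-span t≤m = poly⇒span (poly-^-reduce x^m<m t≤m)
    y^-span : ∀ {t} → t ≤ suc n → y ^ t ∈Span powers {suc n} y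
    y^-span t≤n = poly⇒span (poly-^-reduce y^n<n t≤n)
    shift : ∀ k → (x - y) * W k ∈Span W
    shift k = span-resp {w = W} (sym ([x-y][uv]≈[xu]v-u[yv] x y (x ^ toℕ i) (y ^ toℕ j)))
      (span-+ {w = W} (span-⊗ {X = powers x} {powers y} (x^-span i<m) (y^-span (ℕ.<⇒≤ j<n)))
        (span-neg {w = W} (span-⊗ {X = powers x} {powers y} (x^-span (ℕ.<⇒≤ i<m)) (y^-span j<n))))
      where
      i = proj₁ (remQuot {suc m} (suc n) k)
      j = proj₂ (remQuot {suc m} (suc n) k)
      i<m = Fin.toℕ<n i
      j<n = Fin.toℕ<n j

  integral-root : ∀ {x} d .{{_ : ℕ.NonZero d}} → Integral (x ^ d) → Integral x
  integral-root {x} (suc d) (e , x^de<e) =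
    e ℕ.* suc d ,
    poly-resp (trans (^-assocʳ x (suc d) e) (reflexive (≡.cong (x ^_) (ℕ.*-comm (suc d) e))))
              (poly-∘^ d x^de<e)

module Algebraicity {c ℓ} (Ω : Field c ℓ) {K : Pred Ω} (K-subring : IsSubring (Field.commRing Ω) K) where
  open Field Ω hiding (Carrier)
  open IsSubring K-subring
  open Integrality commRing K-subring
  open import Algebra.Properties.Semiring.Exp semiring using (_^_)
  open import Algebra.Properties.Ring ring using (x[y-z]≈xy-xz)
  open import Algebra.Properties.AbelianGroup +-abelianGroup using (⁻¹-∙-comm)
  open import Algebra.Properties.CommutativeSemigroup +-commutativeSemigroup using (x∙yz≈y∙xz)
  open import Algebra.Properties.Group +-group using (ε⁻¹≈ε)
  open import Relation.Binary.Reasoning.Setoid setoid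

  monic-polynomial : ∀ {v x n} → v ∈K[ x ]< n →
                     Σ (Poly Ω) λ P → All K P × Any (λ a → ¬ a ≈ 0#) P × eval Ω P x ≈ x ^ n - v
  monic-polynomial {x = x} (nil v≈0) =
    1# ∷ [] , 1∈ All.∷ All.[] , here 1≉0 ,
    +-congˡ (trans (zeroʳ x) (sym (trans (-‿cong v≈0) ε⁻¹≈ε)))
  monic-polynomial {v} {x} {suc n} (horner {a = a} {b} a∈K p v≈) with monic-polynomial p
  ... | P , P⊆K , P≢0 , P[x]≈ = - a ∷ P , -‿closed a∈K All.∷ P⊆K , there P≢0 , (begin
    - a + x * eval Ω P x           ≈⟨ +-congˡ (*-congˡ P[x]≈) ⟩
    - a + x * (x ^ n - b)          ≈⟨ +-congˡ (x[y-z]≈xy-xz x (x ^ n) b) ⟩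
    - a + (x * x ^ n - x * b)      ≈⟨ x∙yz≈y∙xz (- a) (x * x ^ n) (- (x * b)) ⟩
    x * x ^ n + (- a + - (x * b))  ≈⟨ +-congˡ (⁻¹-∙-comm a (x * b)) ⟩
    x * x ^ n - (a + x * b)        ≈⟨ +-congˡ (-‿cong (sym v≈)) ⟩
    x * x ^ n - v                  ∎)

  integral⇒algebraic : ∀ {x} → Integral x → Algebraic Ω K x
  integral⇒algebraic (n , x^n<n) with monic-polynomial x^n<n
  ... | P , P⊆K , P≢0 , P[x]≈ = P , P⊆K , P≢0 , trans P[x]≈ (-‿inverseʳ _)

module Unicritical {c ℓ} (Ω : Field c ℓ) {K : Pred Ω} (K-subring : IsSubring (Field.commRing Ω) K)
                   (d : ℕ) (2≤d : 2 ≤ d) (λ′ : Carrier Ω) where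
  open Field Ω hiding (Carrier)
  open IsSubring K-subring
  open Integrality commRing K-subring
  open Algebraicity Ω K-subring
  open import Algebra.Properties.Semiring.Exp semiring using (_^_)
  open import Algebra.Properties.Group +-group using (x≈y⇒x∙y⁻¹≈ε; //-rightDividesʳ)

  instance
    d-nonZero : ℕ.NonZero d
    d-nonZero = ℕ.>-nonZero (ℕ.<-≤-trans (s≤s z≤n) 2≤d)

  pow≡^ : ∀ z n → pow Ω z n ≡ z ^ n
  pow≡^ z zero    = ≡.refl
  pow≡^ z (suc n) = ≡.cong (z *_) (pow≡^ z n)

  f≡ : ∀ z → f Ω d λ′ z ≡ z ^ d + λ′
  f≡ z = ≡.cong (_+ λ′) (pow≡^ z d)

  iter-suc : ∀ k z → iter Ω d λ′ (suc k) z ≡ iter Ω d λ′ k (f Ω d λ′ z)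
  iter-suc zero    z = ≡.refl
  iter-suc (suc k) z = ≡.cong (f Ω d λ′) (iter-suc k z)

  iter-monic : ∀ {α} → K α → ∀ k → Monic λ′ (d ℕ.^ k) (iter Ω d λ′ (suc k) α)
  iter-monic α∈K zero =
    monic-resp (trans (+-comm _ _) (reflexive (≡.sym (f≡ _)))) (monic-+ monic-x (poly-const (^-closed d α∈K)))
  iter-monic α∈K (suc k) =
    monic-resp (reflexive (≡.sym (f≡ _)))
      (monic-+ (monic-^ (iter-monic α∈K k) d) (poly-weaken (ℕ.*-mono-≤ 2≤d (ℕ.m^n>0 d k)) λ′<2))
    where
    -- the only place where d ≥ 2 is needed: λ′ must have lower degree than d · dᵏ
    λ′<2 : λ′ ∈K[ λ′ ]< 2
    λ′<2 = poly-resp (*-identityʳ λ′) (poly-^ 1)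

  parameter-integral : ∀ {α β} n → K α → K β → iter Ω d λ′ (suc n) α ≈ β → Integral λ′
  parameter-integral n α∈K β∈K α-reaches =
    monic-zero⇒integral (monic-resp (x≈y⇒x∙y⁻¹≈ε α-reaches)
      (monic-+ (iter-monic α∈K n) (poly-weaken (ℕ.m^n>0 d n) (poly-const (-‿closed β∈K)))))

  integral-backward : Integral λ′ → ∀ k {z} → Integral (iter Ω d λ′ k z) → Integral z
  integral-backward λ′-int zero        z-int    = z-int
  integral-backward λ′-int (suc k) {z} iter-int =
    integral-root d (integral-resp (//-rightDividesʳ λ′ (z ^ d)) (integral-sub f-int λ′-int))
    where
    f-int : Integral (z ^ d + λ′)
    f-int = ≡.subst Integral (f≡ z) (integral-backward λ′-int k (≡.subst Integral (iter-suc k z) iter-int))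

  common-target⇒algebraic : ∀ {α α′ β} → K α′ → K β → ∀ m n →
                            iter Ω d λ′ m α ≈ β → iter Ω d λ′ (suc n) α′ ≈ β → Algebraic Ω K α
  common-target⇒algebraic α′∈K β∈K m n α-reaches α′-reaches =
    integral⇒algebraic (integral-backward (parameter-integral n α′∈K β∈K α′-reaches) m
                                          (integral-resp (sym α-reaches) (∈K⇒integral β∈K)))

Gen-subring : ∀ {c ℓ} (Ω : Field c ℓ) S → IsSubring (Field.commRing Ω) (Gen Ω S)
Gen-subring Ω S = record { 0∈ = zer ; 1∈ = one ; +-closed = plus ; -‿closed = neg ; *-closed = mul }

lemma3p5 : {c ℓ : Level} (Ω : Field c ℓ) →
    (L : Pred Ω) → IsAlgClosureOf Ω L →
    (p : ℕ) → Prime p → HasChar Ω p →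
    (d : ℕ) → 2 ≤ d →
    (α₁ α₂ β : Carrier Ω) → L α₁ → L α₂ → L β →
    Σ (Carrier Ω) (InC Ω d α₁ α₂ β) →
    Algebraic Ω (Gen Ω (α₂ ∷ β ∷ [])) α₁ × Algebraic Ω (Gen Ω (α₁ ∷ β ∷ [])) α₂
lemma3p5 Ω _ _ _ _ _ d 2≤d α₁ α₂ β _ _ _ (λ′ , suc m , suc n , s≤s z≤n , s≤s z≤n , α₁-reaches , α₂-reaches) =
  algebraic (suc m) n α₁-reaches α₂-reaches , algebraic (suc n) m α₂-reaches α₁-reaches
  where
  open Field Ω using (_≈_; refl)
  algebraic : ∀ {x y} m n → iter Ω d λ′ m x ≈ β → iter Ω d λ′ (suc n) y ≈ β →
              Algebraic Ω (Gen Ω (y ∷ β ∷ [])) x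
  algebraic = Unicritical.common-target⇒algebraic Ω (Gen-subring Ω _) d 2≤d λ′
                (gen (here refl)) (gen (there (here refl)))
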